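{- Suppose $s$, $l$, and $a$ are nonnegative integers such that $l \geq 2$, $a > s+2$, and $(a-s-1)$ does not divide $(l+s+1)$. Let $q=\lfloor(l+s+1)/(a-s-1)\rfloor$ and $$u = \big((1+q)(a-s-1)-(l+s+1)\big)q.$$ If $b$ is an integer with $b \geq a$ and $$b \geq (l+s+1)^s\left(\binom{l+s+1}{l+1} + \binom{l+s+1}{l} (q+1) - \binom{u}{l}\right),$$ then $\tau_s(a,b) \geq l$.
   Context: Convention: $\binom{x}{y}=0$ when $x<y$. All graphs are finite and simple. For graphs $G,H$ on disjoint vertex sets, the join $G \vee H$ is the graph consisting of $G$, $H$, and all edges joining a vertex of $G$ to a vertex of $H$; $K_n$ is the complete graph on $n$ vertices, and $K_0 \vee G$ is understood as $G$. $K_{a,b}$ is the complete bipartite graph with partite sets of sizes $a$ and $b$. $\chi$ denotes chromatic number and $\chi_\ell$ list chromatic number. For a nonnegative integer $s$ and positive integers $a \le b$, $\tau_s(a,b)$ denotes the smallest nonnegative integer $n$ such that $\chi_\ell(K_n \vee K_{a,b}) - \chi(K_n \vee K_{a,b}) \leq s$. -}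

module Defs where

open import Data.Nat using (ℕ; zero; suc; _+_; _*_; _∸_; _^_; _≤_; _<_; NonZero; >-nonZero)
open import Data.Nat.Properties using (m<n⇒0<n∸m; <-trans; n<1+n; +-suc; +-comm)
open import Data.Nat.DivMod using (_/_)
open import Data.Fin using (Fin; splitAt)
open import Data.Sum using (_⊎_; inj₁; inj₂)
open import Data.Product using (Σ; _×_; _,_)
open import Data.Unit using (⊤; tt)
open import Data.Empty using (⊥)
open import Relation.Nullary using (¬_)
open import Relation.Binary.PropositionalEquality using (_≡_; _≢_; refl; sym; subst)
open import Function.Definitions using (Injective)

record Graph : Set₁ where
  field
    size   : ℕ
    Adj    : Fin size → Fin size → Set
    adj-sym : ∀ {u v} → Adj u v → Adj v u
    irrefl : ∀ {v} → ¬ Adj v v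
open Graph public

K : ℕ → Graph
K n = record { size = n ; Adj = λ u v → u ≢ v ; adj-sym = λ p q → p (sym q) ; irrefl = λ p → p refl }

bipAdj : ∀ {a b} → Fin a ⊎ Fin b → Fin a ⊎ Fin b → Set
bipAdj (inj₁ _) (inj₁ _) = ⊥
bipAdj (inj₁ _) (inj₂ _) = ⊤
bipAdj (inj₂ _) (inj₁ _) = ⊤
bipAdj (inj₂ _) (inj₂ _) = ⊥

bipSym : ∀ {a b} (x y : Fin a ⊎ Fin b) → bipAdj x y → bipAdj y x
bipSym (inj₁ _) (inj₂ _) _ = tt
bipSym (inj₂ _) (inj₁ _) _ = tt

bipIrr : ∀ {a b} (x : Fin a ⊎ Fin b) → ¬ bipAdj x x
bipIrr (inj₁ _) ()
bipIrr (inj₂ _) ()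

Kbip : ℕ → ℕ → Graph
Kbip a b = record
  { size = a + b
  ; Adj = λ u v → bipAdj (splitAt a u) (splitAt a v)
  ; adj-sym = λ {u} {v} → bipSym (splitAt a u) (splitAt a v)
  ; irrefl = λ {v} → bipIrr (splitAt a v) }

joinAdj : (G H : Graph) → Fin (size G) ⊎ Fin (size H) → Fin (size G) ⊎ Fin (size H) → Set
joinAdj G H (inj₁ x) (inj₁ y) = Adj G x y
joinAdj G H (inj₁ _) (inj₂ _) = ⊤
joinAdj G H (inj₂ _) (inj₁ _) = ⊤
joinAdj G H (inj₂ x) (inj₂ y) = Adj H x y

joinSym : (G H : Graph) (x y : Fin (size G) ⊎ Fin (size H)) → joinAdj G H x y → joinAdj G H y x
joinSym G H (inj₁ x) (inj₁ y) p = adj-sym G p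
joinSym G H (inj₁ _) (inj₂ _) _ = tt
joinSym G H (inj₂ _) (inj₁ _) _ = tt
joinSym G H (inj₂ x) (inj₂ y) p = adj-sym H p

joinIrr : (G H : Graph) (x : Fin (size G) ⊎ Fin (size H)) → ¬ joinAdj G H x x
joinIrr G H (inj₁ x) = irrefl G
joinIrr G H (inj₂ x) = irrefl H

_∨_ : Graph → Graph → Graph
G ∨ H = record
  { size = size G + size H
  ; Adj = λ u v → joinAdj G H (splitAt (size G) u) (splitAt (size G) v)
  ; adj-sym = λ {u} {v} → joinSym G H (splitAt (size G) u) (splitAt (size G) v)
  ; irrefl = λ {v} → joinIrr G H (splitAt (size G) v) }

Colorable : Graph → ℕ → Set
Colorable G k = Σ (Fin (size G) → Fin k) λ f → ∀ u v → Adj G u v → f u ≢ f v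

-- k-choosable: for every assignment of lists of k distinct colours (colours are natural
-- numbers; L v is an injective map Fin k → ℕ) there is a proper colouring from the lists.
Choosable : Graph → ℕ → Set
Choosable G k =
  (L : Fin (size G) → Fin k → ℕ) → (∀ v → Injective _≡_ _≡_ (L v)) →
  Σ (Fin (size G) → Fin k) λ c → ∀ u v → Adj G u v → L u (c u) ≢ L v (c v)

IsChromaticNumber : Graph → ℕ → Set
IsChromaticNumber G k = Colorable G k × (∀ j → Colorable G j → k ≤ j)

IsListChromaticNumber : Graph → ℕ → Set
IsListChromaticNumber G k = Choosable G k × (∀ j → Choosable G j → k ≤ j)

τ≥ : ℕ → ℕ → ℕ → ℕ → Set
τ≥ s a b l = ∀ n χ χℓ → IsChromaticNumber (K n ∨ Kbip a b) χ →
  IsListChromaticNumber (K n ∨ Kbip a b) χℓ → χℓ ∸ χ ≤ s → l ≤ n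

diffNonZero : ∀ s a → s + 2 < a → NonZero (a ∸ (s + 1))
diffNonZero s a h = >-nonZero (m<n⇒0<n∸m (<-trans (n<1+n (s + 1))
  (subst (_< a) (+-suc s 1) h)))

module Submission where

-- Since χ(Kₙ ∨ K_{a,b}) ≤ n + 2 and adding a clique vertex raises the choice number by at most
-- one, it suffices to show that K_{l-1} ∨ K_{a,b} is not N-choosable, N = l + s + 1.
-- Write N = r(q + 1) + eq with r + e = a - s - 1, and split the base colours 0, …, N - 1 into
-- r big parts of q + 1 colours and e small parts of q colours, ranked within each part. The
-- clique and one centre vertex of A get the base colours, s vertices of A get pairwise disjoint
-- reserved lists, and the remaining r + e vertices of A, one per part, get the base colours with
-- their part replaced by rank colours. Let x be the colour of the centre in a colouring from
-- these lists. The vertex of the part of x either takes a base colour outside that part, and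
-- then clique, centre and it carry l + 1 distinct base colours, or it takes a rank colour,
-- next to the l base colours of clique and centre; if that is the extra rank q + 1, the part
-- of x is big, so these l colours meet the big parts, which excludes C(u, l) sets, u = eq.
-- With one colour of each reserved list this gives one of N^s (C(N,l+1) + C(N,l)(q+1) - C(u,l))
-- patterns, and the vertex of B with that pattern as its list sees all its colours on neighbours.

open import Defs
open import Data.Nat using (ℕ; _+_; _*_; _∸_; _^_; _≤_; _<_)
open import Data.Nat.DivMod using (_/_)
open import Data.Nat.Divisibility using (_∣_)
open import Data.Nat.Combinatorics using (_C_)
open import Relation.Nullary using (¬_)

open import Data.Empty using (⊥; ⊥-elim)
open import Data.Fin using (Fin; zero; suc; toℕ; cast; _↑ˡ_; _↑ʳ_; splitAt; join; remQuot; combine; punchIn; punchOut; inject≤)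
open import Data.Fin.Properties
  using (toℕ-injective; toℕ-cast; splitAt-join; join-splitAt; splitAt⁻¹-↑ˡ; splitAt⁻¹-↑ʳ; combine-remQuot;
         combine-injective; inject≤-injective; any?; punchIn-punchOut; punchInᵢ≢i; punchIn-injective; punchOut-injective)
  renaming (suc-injective to Fin-suc-injective; _≟_ to _≟ᶠ_)
open import Data.List using (List; []; _∷_; _++_; map; length; lookup; allFin; cartesianProduct; cartesianProductWith)
open import Data.List.Properties using (length-++; length-map; length-tabulate)
open import Data.List.Membership.Propositional using (_∈_)
open import Data.List.Membership.Propositional.Properties using (∈-map⁺; ∈-++⁺ˡ; ∈-++⁺ʳ; ∈-cartesianProductWith⁺; ∈-allFin)
open import Data.List.Relation.Unary.Any using (here; index)
open import Data.List.Relation.Unary.Any.Properties using (lookup-index)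
open import Data.Nat using (zero; suc; NonZero; s≤s; z≤n; _≤?_)
open import Data.Nat.Combinatorics using (nCk+nC[k+1]≡[n+1]C[k+1])
open import Data.Nat.DivMod using (_%_; m≡m%n+[m/n]*n; m%n≤n)
open import Data.Nat.Properties
  using (_≟_; +-assoc; +-comm; ≤-trans; <⇒≤; ≤-pred; ≰⇒>; +-mono-≤; +-monoʳ-≤; m≤n+m∸n; m+n∸n≡m; m+[n∸m]≡n;
         m∸n+n≡m; [m+n]∸[m+o]≡n∸o)
open import Data.Nat.Tactic.RingSolver using (solve-∀)
open import Data.Product using (Σ; ∃; _×_; _,_; proj₁; proj₂; uncurry) renaming (map to map×; map₁ to map×₁)
open import Data.Product.Properties using (,-injectiveˡ; ,-injectiveʳ)
open import Data.Sum using (_⊎_; inj₁; inj₂; [_,_]′; map₁; map₂)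
open import Data.Sum.Properties using (inj₁-injective; inj₂-injective; ≡-dec)
open import Data.Unit using (tt)
open import Data.Vec using (Vec; []; _∷_; tabulate) renaming (lookup to lookupᵛ)
open import Data.Vec.Functional using () renaming (_∷_ to _∷ᶠ_)
open import Data.Vec.Properties using (lookup∘tabulate)
open import Function using (_∘_; const)
open import Function.Definitions using (Injective)
open import Relation.Nullary using (yes; no; Dec)
open import Relation.Binary.PropositionalEquality
  using (_≡_; _≢_; refl; sym; trans; cong; cong₂; subst; subst₂; module ≡-Reasoning)

-- Enumerations

length-cartesianProductWith : ∀ {A B C : Set} (f : A → B → C) xs ys →
  length (cartesianProductWith f xs ys) ≡ length xs * length ys
length-cartesianProductWith f []       ys = refl
length-cartesianProductWith f (x ∷ xs) ys = begin
  length (map (f x) ys ++ cartesianProductWith f xs ys)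
    ≡⟨ length-++ (map (f x) ys) ⟩
  length (map (f x) ys) + length (cartesianProductWith f xs ys)
    ≡⟨ cong₂ _+_ (length-map (f x) ys) (length-cartesianProductWith f xs ys) ⟩
  length ys + length xs * length ys ∎
  where open ≡-Reasoning

allVecs : ∀ {A : Set} → List A → ∀ n → List (Vec A n)
allVecs xs zero    = [] ∷ []
allVecs xs (suc n) = cartesianProductWith _∷_ xs (allVecs xs n)

length-allVecs : ∀ {A : Set} (xs : List A) n → length (allVecs xs n) ≡ length xs ^ n
length-allVecs xs zero    = refl
length-allVecs xs (suc n) = trans (length-cartesianProductWith _∷_ xs (allVecs xs n))
                                  (cong (length xs *_) (length-allVecs xs n))

∈-allVecs : ∀ {A : Set} {xs : List A} → (∀ x → x ∈ xs) → ∀ {n} (v : Vec A n) → v ∈ allVecs xs n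
∈-allVecs complete []      = here refl
∈-allVecs complete (x ∷ v) = ∈-cartesianProductWith⁺ _∷_ (complete x) (∈-allVecs complete v)

data Comb : ℕ → ℕ → Set where
  []   : Comb 0 0
  skip : ∀ {n k} → Comb n k → Comb (suc n) k
  keep : ∀ {n k} → Comb n k → Comb (suc n) (suc k)

elem : ∀ {n k} → Comb n k → Fin k → Fin n
elem (skip c) i       = suc (elem c i)
elem (keep c) zero    = zero
elem (keep c) (suc i) = suc (elem c i)

elem-injective : ∀ {n k} (c : Comb n k) → Injective _≡_ _≡_ (elem c)
elem-injective (skip c) eq = elem-injective c (Fin-suc-injective eq)
elem-injective (keep c) {zero}  {zero}  eq = refl
elem-injective (keep c) {suc i} {suc j} eq = cong suc (elem-injective c (Fin-suc-injective eq))

combs : ∀ n k → List (Comb n k)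
combs zero    zero    = [] ∷ []
combs zero    (suc k) = []
combs (suc n) zero    = map skip (combs n zero)
combs (suc n) (suc k) = map keep (combs n k) ++ map skip (combs n (suc k))

length-combs : ∀ n k → length (combs n k) ≡ n C k
length-combs zero    zero    = refl
length-combs zero    (suc k) = refl
length-combs (suc n) zero    = trans (length-map skip (combs n zero)) (length-combs n zero)
length-combs (suc n) (suc k) = begin
  length (map keep (combs n k) ++ map skip (combs n (suc k)))
    ≡⟨ length-++ (map keep (combs n k)) ⟩
  length (map keep (combs n k)) + length (map skip (combs n (suc k)))
    ≡⟨ cong₂ _+_ (length-map keep (combs n k)) (length-map skip (combs n (suc k))) ⟩
  length (combs n k) + length (combs n (suc k))
    ≡⟨ cong₂ _+_ (length-combs n k) (length-combs n (suc k)) ⟩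
  n C k + n C suc k
    ≡⟨ nCk+nC[k+1]≡[n+1]C[k+1] n k ⟩
  suc n C suc k ∎
  where open ≡-Reasoning

∈-combs : ∀ {n k} (c : Comb n k) → c ∈ combs n k
∈-combs []                      = here refl
∈-combs {k = zero}      (skip c) = ∈-map⁺ skip (∈-combs c)
∈-combs {suc n} {suc k} (skip c) = ∈-++⁺ʳ (map keep (combs n k)) (∈-map⁺ skip (∈-combs c))
∈-combs                 (keep c) = ∈-++⁺ˡ (∈-map⁺ keep (∈-combs c))

combsMeeting : ∀ m {u} k → List (Comb (m + u) k)
combsMeeting zero        k       = []
combsMeeting (suc m)     zero    = []
combsMeeting (suc m) {u} (suc k) = map keep (combs (m + u) k) ++ map skip (combsMeeting m (suc k))

length-combsMeeting : ∀ m u k → length (combsMeeting m {u} k) + u C k ≡ (m + u) C k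
length-combsMeeting zero    u k       = refl
length-combsMeeting (suc m) u zero    = refl
length-combsMeeting (suc m) u (suc k) = begin
  length (map keep (combs (m + u) k) ++ map skip (combsMeeting m (suc k))) + u C suc k
    ≡⟨ cong (_+ u C suc k) (length-++ (map keep (combs (m + u) k))) ⟩
  length (map keep (combs (m + u) k)) + length (map skip (combsMeeting m (suc k))) + u C suc k
    ≡⟨ cong₂ (λ x y → x + y + u C suc k) (length-map keep (combs (m + u) k))
                                         (length-map skip (combsMeeting m (suc k))) ⟩
  length (combs (m + u) k) + length (combsMeeting m (suc k)) + u C suc k
    ≡⟨ +-assoc (length (combs (m + u) k)) _ _ ⟩
  length (combs (m + u) k) + (length (combsMeeting m (suc k)) + u C suc k)
    ≡⟨ cong₂ _+_ (length-combs (m + u) k) (length-combsMeeting m u (suc k)) ⟩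
  (m + u) C k + (m + u) C suc k
    ≡⟨ nCk+nC[k+1]≡[n+1]C[k+1] (m + u) k ⟩
  suc (m + u) C suc k ∎
  where open ≡-Reasoning

∈-combsMeeting : ∀ m {u k} (c : Comb (m + u) k) (i : Fin k) (x : Fin m) → elem c i ≡ x ↑ˡ u →
  c ∈ combsMeeting m k
∈-combsMeeting (suc m)             (keep c) i x       eq = ∈-++⁺ˡ (∈-map⁺ keep (∈-combs c))
∈-combsMeeting (suc m) {u} {suc k} (skip c) i (suc x) eq =
  ∈-++⁺ʳ (map keep (combs (m + u) k)) (∈-map⁺ skip (∈-combsMeeting m c i x (Fin-suc-injective eq)))

SameImage : ∀ {A : Set} {k m} → (Fin k → A) → (Fin m → A) → Set
SameImage f g = (∀ i → ∃ λ j → f i ≡ g j) × (∀ j → ∃ λ i → f i ≡ g j)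

image-comb : ∀ {n k} (g : Fin k → Fin n) → Injective _≡_ _≡_ g → Σ (Comb n k) λ c → SameImage (elem c) g
image-comb {zero} {zero}  g g-inj = [] , (λ ()) , (λ ())
image-comb {zero} {suc k} g g-inj with () ← g zero
image-comb {suc n} {k} g g-inj with any? (λ i → zero ≟ᶠ g i)
... | no 0∉g = skip c , c⊆g , g⊆c
  where
  0≢g : ∀ i → zero ≢ g i
  0≢g i 0≡gi = 0∉g (i , 0≡gi)
  g₋ : Fin k → Fin n
  g₋ i = punchOut (0≢g i)
  suc-g₋ : ∀ i → suc (g₋ i) ≡ g i
  suc-g₋ i = punchIn-punchOut (0≢g i)
  rec = image-comb g₋ (λ {i} {j} eq → g-inj (punchOut-injective (0≢g i) (0≢g j) eq))
  c = proj₁ rec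
  c⊆g : ∀ i → ∃ λ j → suc (elem c i) ≡ g j
  c⊆g i = let (j , eq) = proj₁ (proj₂ rec) i in j , trans (cong suc eq) (suc-g₋ j)
  g⊆c : ∀ j → ∃ λ i → suc (elem c i) ≡ g j
  g⊆c j = let (i , eq) = proj₂ (proj₂ rec) j in i , trans (cong suc eq) (suc-g₋ j)
image-comb {suc n} {suc k} g g-inj | yes (i₀ , 0≡gi₀) = keep c , c⊆g , g⊆c
  where
  0≢g : ∀ j → zero ≢ g (punchIn i₀ j)
  0≢g j 0≡g[j] = punchInᵢ≢i i₀ j (g-inj (trans (sym 0≡g[j]) 0≡gi₀))
  g₋ : Fin k → Fin n
  g₋ j = punchOut (0≢g j)
  suc-g₋ : ∀ j → suc (g₋ j) ≡ g (punchIn i₀ j)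
  suc-g₋ j = punchIn-punchOut (0≢g j)
  rec = image-comb g₋ (λ {i} {j} eq → punchIn-injective i₀ i j (g-inj (punchOut-injective (0≢g i) (0≢g j) eq)))
  c = proj₁ rec
  c⊆g : ∀ i → ∃ λ j → elem (keep c) i ≡ g j
  c⊆g zero    = i₀ , 0≡gi₀
  c⊆g (suc i) = let (j , eq) = proj₁ (proj₂ rec) i in punchIn i₀ j , trans (cong suc eq) (suc-g₋ j)
  g⊆c : ∀ j → ∃ λ i → elem (keep c) i ≡ g j
  g⊆c j with i₀ ≟ᶠ j
  ... | yes refl = zero , 0≡gi₀
  ... | no i₀≢j  = let (i , eq) = proj₂ (proj₂ rec) (punchOut i₀≢j) in
    suc i , trans (cong suc eq) (trans (suc-g₋ (punchOut i₀≢j)) (cong g (punchIn-punchOut i₀≢j)))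

∷-injective : ∀ {A : Set} {k} {x : A} {f : Fin k → A} → Injective _≡_ _≡_ f → (∀ i → f i ≢ x) →
  Injective _≡_ _≡_ (x ∷ᶠ f)
∷-injective f-inj x∉f {zero}  {zero}  eq = refl
∷-injective f-inj x∉f {zero}  {suc j} eq = ⊥-elim (x∉f j (sym eq))
∷-injective f-inj x∉f {suc i} {zero}  eq = ⊥-elim (x∉f i eq)
∷-injective f-inj x∉f {suc i} {suc j} eq = cong suc (f-inj eq)

splitAt-injective : ∀ m {n} → Injective _≡_ _≡_ (splitAt m {n})
splitAt-injective m {n} {i} {j} eq = trans (sym (join-splitAt m n i)) (trans (cong (join m n) eq) (join-splitAt m n j))

join-injective : ∀ m n → Injective _≡_ _≡_ (join m n)
join-injective m n {x} {y} eq = trans (sym (splitAt-join m n x)) (trans (cong (splitAt m) eq) (splitAt-join m n y))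

join-map₂-injective : ∀ m n {B : Set} {f : B → Fin n} → Injective _≡_ _≡_ f → Injective _≡_ _≡_ (join m n ∘ map₂ f)
join-map₂-injective m n         f-inj {inj₁ x} {inj₁ y} eq = cong inj₁ (inj₁-injective (join-injective m n eq))
join-map₂-injective m n         f-inj {inj₂ x} {inj₂ y} eq = cong inj₂ (f-inj (inj₂-injective (join-injective m n eq)))
join-map₂-injective m n {f = f} f-inj {inj₁ x} {inj₂ y} eq with () ← join-injective m n {inj₁ x} {inj₂ (f y)} eq
join-map₂-injective m n {f = f} f-inj {inj₂ x} {inj₁ y} eq with () ← join-injective m n {inj₂ (f x)} {inj₁ y} eq

remQuot-injective : ∀ {m} n → Injective _≡_ _≡_ (remQuot {m} n)
remQuot-injective {m} n {i} {j} eq =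
  trans (sym (combine-remQuot {m} n i)) (trans (cong (uncurry (combine {m} {n})) eq) (combine-remQuot {m} n j))

-- Colourings and choosability of joins

adj-join : ∀ G H x y → joinAdj G H x y → Adj (G ∨ H) (join (size G) (size H) x) (join (size G) (size H) y)
adj-join G H x y = subst₂ (joinAdj G H) (sym (splitAt-join (size G) (size H) x)) (sym (splitAt-join (size G) (size H) y))

adj-Kbip : ∀ {a b} (x y : Fin a ⊎ Fin b) → bipAdj x y → Adj (Kbip a b) (join a b x) (join a b y)
adj-Kbip {a} {b} x y = subst₂ bipAdj (sym (splitAt-join a b x)) (sym (splitAt-join a b y))

K-colorable : ∀ n → Colorable (K n) n
K-colorable n = (λ v → v) , λ u v u≢v → u≢v

Kbip-colorable : ∀ a b → Colorable (Kbip a b) 2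
Kbip-colorable a b = side ∘ splitAt a , λ u v → proper (splitAt a u) (splitAt a v)
  where
  side : Fin a ⊎ Fin b → Fin 2
  side = [ const zero , const (suc zero) ]′
  proper : ∀ x y → bipAdj x y → side x ≢ side y
  proper (inj₁ _) (inj₂ _) _ ()
  proper (inj₂ _) (inj₁ _) _ ()

∨-colorable : ∀ G H {c d} → Colorable G c → Colorable H d → Colorable (G ∨ H) (c + d)
∨-colorable G H {c} {d} (f , f-proper) (g , g-proper) =
  colour ∘ splitAt (size G) , λ u v → proper (splitAt (size G) u) (splitAt (size G) v)
  where
  colour : Fin (size G) ⊎ Fin (size H) → Fin (c + d)
  colour = join c d ∘ [ inj₁ ∘ f , inj₂ ∘ g ]′
  proper : ∀ x y → joinAdj G H x y → colour x ≢ colour y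
  proper (inj₁ u) (inj₁ v) adj eq = f-proper u v adj (inj₁-injective (join-injective c d eq))
  proper (inj₁ u) (inj₂ v) adj eq with () ← join-injective c d {inj₁ (f u)} {inj₂ (g v)} eq
  proper (inj₂ u) (inj₁ v) adj eq with () ← join-injective c d {inj₂ (g u)} {inj₁ (f v)} eq
  proper (inj₂ u) (inj₂ v) adj eq = g-proper u v adj (inj₂-injective (join-injective c d eq))

choosable-mono : ∀ G {c d} → c ≤ d → Choosable G c → Choosable G d
choosable-mono G c≤d choose L L-inj =
  let (κ , proper) = choose (λ v j → L v (inject≤ j c≤d)) (λ v eq → inject≤-injective c≤d c≤d _ _ (L-inj v eq))
  in (λ v → inject≤ (κ v) c≤d) , proper

choosable⇒proper-from : ∀ {C : Set} G {k} (encode : C → ℕ) → Injective _≡_ _≡_ encode → Choosable G k →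
  (L : Fin (size G) → Fin k → C) → (∀ v → Injective _≡_ _≡_ (L v)) →
  Σ (Fin (size G) → Fin k) λ κ → ∀ u v → Adj G u v → L u (κ u) ≢ L v (κ v)
choosable⇒proper-from G encode encode-inj choose L L-inj =
  let (κ , proper) = choose (λ v → encode ∘ L v) (λ v → L-inj v ∘ encode-inj)
  in κ , λ u v adj eq → proper u v adj (cong encode eq)

choosable-from-gap : ∀ G {χ χℓ s c} → IsChromaticNumber G χ → IsListChromaticNumber G χℓ → χℓ ∸ χ ≤ s →
  Colorable G c → Choosable G (c + s)
choosable-from-gap G {χ} {χℓ} (_ , χ-least) (choosable , _) gap colorable =
  choosable-mono G (≤-trans (m≤n+m∸n χℓ χ) (+-mono-≤ (χ-least _ colorable) gap)) choosable

avoiding-position : ∀ {c} (f : Fin (suc c) → ℕ) → Injective _≡_ _≡_ f → ∀ x → ∃ λ p → ∀ j → f (punchIn p j) ≢ x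
avoiding-position f f-inj x with any? (λ p → f p ≟ x)
... | yes (p , fp≡x) = p , λ j eq → punchInᵢ≢i p j (f-inj (trans eq (sym fp≡x)))
... | no x∉f         = zero , λ j eq → x∉f (punchIn zero j , eq)

adj-K∨-pred : ∀ n H u v → Adj (K (suc n) ∨ H) (suc u) (suc v) → Adj (K n ∨ H) u v
adj-K∨-pred n H u v = pred (splitAt n u) (splitAt n v)
  where
  pred : ∀ x y → joinAdj (K (suc n)) H (map₁ suc x) (map₁ suc y) → joinAdj (K n) H x y
  pred (inj₁ i) (inj₁ j) suc-i≢suc-j i≡j = suc-i≢suc-j (cong suc i≡j)
  pred (inj₁ _) (inj₂ _) adj = adj
  pred (inj₂ _) (inj₁ _) adj = adj
  pred (inj₂ _) (inj₂ _) adj = adj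

-- The new clique vertex takes the first colour of its list; every other vertex drops that colour.
K∨-choosable-suc : ∀ n H {c} → Choosable (K n ∨ H) c → Choosable (K (suc n) ∨ H) (suc c)
K∨-choosable-suc n H {c} choose L L-inj = κ , proper
  where
  c₀ = L zero zero
  avoid : ∀ v → ∃ λ p → ∀ j → L (suc v) (punchIn p j) ≢ c₀
  avoid v = avoiding-position (L (suc v)) (L-inj (suc v)) c₀
  p : Fin (size (K n ∨ H)) → Fin (suc c)
  p v = proj₁ (avoid v)
  rec = choose (λ v → L (suc v) ∘ punchIn (p v)) (λ v eq → punchIn-injective (p v) _ _ (L-inj (suc v) eq))
  κ : Fin (size (K (suc n) ∨ H)) → Fin (suc c)
  κ zero    = zero
  κ (suc v) = punchIn (p v) (proj₁ rec v)
  proper : ∀ u v → Adj (K (suc n) ∨ H) u v → L u (κ u) ≢ L v (κ v)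
  proper zero    zero    adj = ⊥-elim (irrefl (K (suc n) ∨ H) {zero} adj)
  proper zero    (suc v) _   = λ eq → proj₂ (avoid v) (proj₁ rec v) (sym eq)
  proper (suc u) zero    _   = proj₂ (avoid u) (proj₁ rec u)
  proper (suc u) (suc v) adj = proj₂ rec u v (adj-K∨-pred n H u v adj)

K∨-choosable-+ : ∀ j n H {c} → Choosable (K n ∨ H) c → Choosable (K (j + n) ∨ H) (j + c)
K∨-choosable-+ zero    n H choosable = choosable
K∨-choosable-+ (suc j) n H choosable = K∨-choosable-suc (j + n) H (K∨-choosable-+ j n H choosable)

K∨-choosable-from-gap : ∀ {n m} H {c χ χℓ s} → n ≤ m → Colorable H c →
  IsChromaticNumber (K n ∨ H) χ → IsListChromaticNumber (K n ∨ H) χℓ → χℓ ∸ χ ≤ s →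
  Choosable (K m ∨ H) (m + c + s)
K∨-choosable-from-gap {n} {m} H {c} {s = s} n≤m H-colorable is-χ is-χℓ gap =
  subst₂ (λ x y → Choosable (K x ∨ H) y) (m∸n+n≡m n≤m) sizes
    (K∨-choosable-+ (m ∸ n) n H
      (choosable-from-gap (K n ∨ H) is-χ is-χℓ gap (∨-colorable (K n) H (K-colorable n) H-colorable)))
  where
  reassociate : ∀ x n c s → x + (n + c + s) ≡ x + n + c + s
  reassociate = solve-∀
  sizes : m ∸ n + (n + c + s) ≡ m + c + s
  sizes = trans (reassociate (m ∸ n) n c s) (cong (λ x → x + c + s) (m∸n+n≡m n≤m))

-- The r big parts fill the first r(q + 1) colours; rank zero is the extra rank that only big parts have.
module Partition (r e q : ℕ) where

  place : Fin (r * suc q + e * q) → (Fin r ⊎ Fin e) × Fin (suc q)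
  place j with splitAt (r * suc q) j
  ... | inj₁ i = map×₁ inj₁ (remQuot (suc q) i)
  ... | inj₂ i = map× inj₂ suc (remQuot q i)

  part : Fin (r * suc q + e * q) → Fin r ⊎ Fin e
  part = proj₁ ∘ place

  rank : Fin (r * suc q + e * q) → Fin (suc q)
  rank = proj₂ ∘ place

  _≟ₚ_ : (x y : Fin r ⊎ Fin e) → Dec (x ≡ y)
  _≟ₚ_ = ≡-dec _≟ᶠ_ _≟ᶠ_

  private
    big : Fin r × Fin (suc q) → (Fin r ⊎ Fin e) × Fin (suc q)
    big = map×₁ inj₁
    small : Fin e × Fin q → (Fin r ⊎ Fin e) × Fin (suc q)
    small = map× inj₂ suc
    big-injective : Injective _≡_ _≡_ big
    big-injective {_ , _} {_ , _} refl = refl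
    small-injective : Injective _≡_ _≡_ small
    small-injective {_ , _} {_ , _} refl = refl
    big≢small : ∀ x y → big x ≢ small y
    big≢small (_ , _) (_ , _) ()

  place-injective : Injective _≡_ _≡_ place
  place-injective {j} {j′} eq with splitAt (r * suc q) j in ej | splitAt (r * suc q) j′ in ej′
  ... | inj₁ i | inj₁ i′ = trans (sym (splitAt⁻¹-↑ˡ ej))
    (trans (cong (_↑ˡ e * q) (remQuot-injective (suc q) (big-injective eq))) (splitAt⁻¹-↑ˡ ej′))
  ... | inj₁ i | inj₂ i′ = ⊥-elim (big≢small _ _ eq)
  ... | inj₂ i | inj₁ i′ = ⊥-elim (big≢small _ _ (sym eq))
  ... | inj₂ i | inj₂ i′ = trans (sym (splitAt⁻¹-↑ʳ ej))
    (trans (cong (r * suc q ↑ʳ_) (remQuot-injective q (small-injective eq))) (splitAt⁻¹-↑ʳ ej′))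

  rank≡0⇒prefix : ∀ {j x} → rank j ≡ zero → part x ≡ part j → ∃ λ i → i ↑ˡ e * q ≡ x
  rank≡0⇒prefix {j} {x} rank≡0 parts≡ with splitAt (r * suc q) j | splitAt (r * suc q) x in ex
  ... | inj₁ _ | inj₁ i = i , splitAt⁻¹-↑ˡ ex
  rank≡0⇒prefix () _ | inj₂ _ | _
  rank≡0⇒prefix _ () | inj₁ _ | inj₂ _

-- The list assignment

module Construction (s n q r e : ℕ) (s+n+2≡N : s + suc (suc n) ≡ r * suc q + e * q) where

  N : ℕ
  N = r * suc q + e * q

  open Partition r e q

  Colour : Set
  Colour = Fin N ⊎ (Fin (suc q) ⊎ (Fin s × Fin N))

  pattern base j       = inj₁ j
  pattern ranked y     = inj₂ (inj₁ y)
  pattern reserved t j = inj₂ (inj₂ (t , j))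

  encode : Colour → ℕ
  encode = toℕ ∘ join N _ ∘ map₂ (join (suc q) (s * N) ∘ map₂ (uncurry combine))

  encode-injective : Injective _≡_ _≡_ encode
  encode-injective = join-map₂-injective N _ (join-map₂-injective (suc q) _ combine-injective′) ∘ toℕ-injective
    where
    combine-injective′ : Injective _≡_ _≡_ (uncurry (combine {s} {N}))
    combine-injective′ {t , j} {t′ , j′} eq =
      let (t≡t′ , j≡j′) = combine-injective t j t′ j′ eq in cong₂ _,_ t≡t′ j≡j′

  shiftedList : Fin r ⊎ Fin e → Fin N → Colour
  shiftedList p j with part j ≟ₚ p
  ... | yes _ = ranked (rank j)
  ... | no _  = base j

  shiftedList-inside : ∀ {p j} → part j ≡ p → shiftedList p j ≡ ranked (rank j)
  shiftedList-inside {p} {j} j∈p with part j ≟ₚ p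
  ... | yes _   = refl
  ... | no j∉p = ⊥-elim (j∉p j∈p)

  shiftedList-outside : ∀ {p j} → part j ≢ p → shiftedList p j ≡ base j
  shiftedList-outside {p} {j} j∉p with part j ≟ₚ p
  ... | yes j∈p = ⊥-elim (j∉p j∈p)
  ... | no _    = refl

  shiftedList-injective : ∀ p → Injective _≡_ _≡_ (shiftedList p)
  shiftedList-injective p {j} {j′} eq with part j ≟ₚ p | part j′ ≟ₚ p
  ... | yes j∈p | yes j′∈p =
    place-injective (cong₂ _,_ (trans j∈p (sym j′∈p)) (inj₁-injective (inj₂-injective eq)))
  ... | no _    | no _     = inj₁-injective eq
  shiftedList-injective p () | yes _ | no _
  shiftedList-injective p () | no _  | yes _

  data Blocker : Set where
    full     : Comb N (suc (suc n)) → Blocker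
    withRank : Fin (suc q) → Comb N (suc n) → Blocker

  blockerList : Blocker → Fin (suc (suc n)) → Colour
  blockerList (full c)       i       = base (elem c i)
  blockerList (withRank y c) zero    = ranked y
  blockerList (withRank y c) (suc i) = base (elem c i)

  blockerList-injective : ∀ Y → Injective _≡_ _≡_ (blockerList Y)
  blockerList-injective (full c)       eq = elem-injective c (inj₁-injective eq)
  blockerList-injective (withRank y c) {zero}  {zero}  eq = refl
  blockerList-injective (withRank y c) {suc i} {suc j} eq = cong suc (elem-injective c (inj₁-injective eq))
  blockerList-injective (withRank y c) {zero}  {suc j} ()
  blockerList-injective (withRank y c) {suc i} {zero}  ()

  blockerList-unreserved : ∀ Y i {t j} → blockerList Y i ≢ reserved t j
  blockerList-unreserved (full c)       i       ()
  blockerList-unreserved (withRank y c) zero    ()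
  blockerList-unreserved (withRank y c) (suc i) ()

  -- With the extra rank, only combinations meeting a big part can occur.
  blockers : List Blocker
  blockers = map full (combs N (suc (suc n)))
          ++ cartesianProductWith (withRank ∘ suc) (allFin q) (combs N (suc n))
          ++ map (withRank zero) (combsMeeting (r * suc q) (suc n))

  full-∈ : ∀ c → full c ∈ blockers
  full-∈ c = ∈-++⁺ˡ (∈-map⁺ full (∈-combs c))

  withRank-suc-∈ : ∀ y c → withRank (suc y) c ∈ blockers
  withRank-suc-∈ y c = ∈-++⁺ʳ (map full (combs N (suc (suc n))))
    (∈-++⁺ˡ (∈-cartesianProductWith⁺ (withRank ∘ suc) (∈-allFin y) (∈-combs c)))

  withRank-zero-∈ : ∀ c i x → elem c i ≡ x ↑ˡ e * q → withRank zero c ∈ blockers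
  withRank-zero-∈ c i x eq = ∈-++⁺ʳ (map full (combs N (suc (suc n))))
    (∈-++⁺ʳ (cartesianProductWith (withRank ∘ suc) (allFin q) (combs N (suc n)))
      (∈-map⁺ (withRank zero) (∈-combsMeeting (r * suc q) c i x eq)))

  length-blockers : length blockers ≡ N C (suc n + 1) + (N C suc n) * (q + 1) ∸ (e * q) C suc n
  length-blockers = begin
    length blockers
      ≡⟨ length-++ (map full (combs N (suc (suc n)))) {ranked-part ++ top-part} ⟩
    length (map full (combs N (suc (suc n)))) + length (ranked-part ++ top-part)
      ≡⟨ cong₂ _+_ (trans (length-map full (combs N (suc (suc n)))) (length-combs N (suc (suc n))))
                   (length-++ ranked-part {top-part}) ⟩
    N C suc (suc n) + (length ranked-part + length top-part)
      ≡⟨ cong₂ (λ x y → N C suc (suc n) + (x + y)) length-ranked-part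
               (length-map (withRank zero) (combsMeeting (r * suc q) (suc n))) ⟩
    N C suc (suc n) + (q * (N C suc n) + W)
      ≡⟨ cong (λ x → N C x + (q * (N C suc n) + W)) (+-comm 1 (suc n)) ⟩
    N C (suc n + 1) + (q * (N C suc n) + W)
      ≡⟨ m+n∸n≡m _ Z ⟨
    N C (suc n + 1) + (q * (N C suc n) + W) + Z ∸ Z
      ≡⟨ cong (_∸ Z) (rearrange (N C (suc n + 1)) (N C suc n) W Z q) ⟩
    N C (suc n + 1) + (N C suc n) * q + (W + Z) ∸ Z
      ≡⟨ cong (λ x → N C (suc n + 1) + (N C suc n) * q + x ∸ Z) (length-combsMeeting (r * suc q) (e * q) (suc n)) ⟩
    N C (suc n + 1) + (N C suc n) * q + N C suc n ∸ Z
      ≡⟨ cong (_∸ Z) (distribute (N C (suc n + 1)) (N C suc n) q) ⟩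
    N C (suc n + 1) + (N C suc n) * (q + 1) ∸ Z ∎
    where
    open ≡-Reasoning
    ranked-part = cartesianProductWith (withRank ∘ suc) (allFin q) (combs N (suc n))
    top-part = map (withRank zero) (combsMeeting (r * suc q) (suc n))
    W = length (combsMeeting (r * suc q) {e * q} (suc n))
    Z = (e * q) C suc n
    length-ranked-part : length ranked-part ≡ q * (N C suc n)
    length-ranked-part = trans (length-cartesianProductWith (withRank ∘ suc) (allFin q) (combs N (suc n)))
                               (cong₂ _*_ (length-tabulate {n = q} (λ i → i)) (length-combs N (suc n)))
    rearrange : ∀ X C W Z q → X + (q * C + W) + Z ≡ X + C * q + (W + Z)
    rearrange = solve-∀
    distribute : ∀ X C q → X + C * q + C ≡ X + C * (q + 1)
    distribute = solve-∀

  Pattern : Set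
  Pattern = Vec (Fin N) s × Blocker

  patterns : List Pattern
  patterns = cartesianProduct (allVecs (allFin N) s) blockers

  length-patterns : length patterns ≡ N ^ s * (N C (suc n + 1) + (N C suc n) * (q + 1) ∸ (e * q) C suc n)
  length-patterns = trans (length-cartesianProductWith _,_ (allVecs (allFin N) s) blockers)
    (cong₂ _*_ (trans (length-allVecs (allFin N) s) (cong (_^ s) (length-tabulate {n = N} (λ i → i))))
               length-blockers)

  patternEntry : Pattern → Fin s ⊎ Fin (suc (suc n)) → Colour
  patternEntry (τ , Y) = [ (λ t → reserved t (lookupᵛ τ t)) , blockerList Y ]′

  patternEntry-injective : ∀ P → Injective _≡_ _≡_ (patternEntry P)
  patternEntry-injective (τ , Y) {inj₁ t} {inj₁ t′} eq = cong inj₁ (,-injectiveˡ (inj₂-injective (inj₂-injective eq)))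
  patternEntry-injective (τ , Y) {inj₂ i} {inj₂ i′} eq = cong inj₂ (blockerList-injective Y eq)
  patternEntry-injective (τ , Y) {inj₁ t} {inj₂ i}  eq = ⊥-elim (blockerList-unreserved Y i (sym eq))
  patternEntry-injective (τ , Y) {inj₂ i} {inj₁ t}  eq = ⊥-elim (blockerList-unreserved Y i eq)

  split : Fin N → Fin s ⊎ Fin (suc (suc n))
  split = splitAt s ∘ cast (sym s+n+2≡N)

  split-injective : Injective _≡_ _≡_ split
  split-injective eq =
    toℕ-injective (trans (sym (toℕ-cast _ _)) (trans (cong toℕ (splitAt-injective s eq)) (toℕ-cast _ _)))

  patternList : Pattern → Fin N → Colour
  patternList P = patternEntry P ∘ split

  patternList-injective : ∀ P → Injective _≡_ _≡_ (patternList P)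
  patternList-injective P = split-injective ∘ patternEntry-injective P

  module Assignment (k : ℕ) where

    a b : ℕ
    a = s + suc (r + e)
    b = length patterns + k

    G : Graph
    G = K n ∨ Kbip a b

    data Role : Set where
      clique  : Fin n → Role
      owner   : Fin s → Role
      centre  : Role
      shifted : Fin r ⊎ Fin e → Role
      blocker : Fin (length patterns) → Role
      spare   : Fin k → Role

    aVertex : Fin a → Fin (size G)
    aVertex α = join n (a + b) (inj₂ (join a b (inj₁ α)))

    bVertex : Fin b → Fin (size G)
    bVertex β = join n (a + b) (inj₂ (join a b (inj₂ β)))

    vertex : Role → Fin (size G)
    vertex (clique i)  = join n (a + b) (inj₁ i)
    vertex (owner t)   = aVertex (join s (suc (r + e)) (inj₁ t))
    vertex centre      = aVertex (join s (suc (r + e)) (inj₂ zero))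
    vertex (shifted p) = aVertex (join s (suc (r + e)) (inj₂ (suc (join r e p))))
    vertex (blocker β) = bVertex (join (length patterns) k (inj₁ β))
    vertex (spare i)   = bVertex (join (length patterns) k (inj₂ i))

    aRole : Fin s ⊎ Fin (suc (r + e)) → Role
    aRole (inj₁ t)       = owner t
    aRole (inj₂ zero)    = centre
    aRole (inj₂ (suc p)) = shifted (splitAt r p)

    bRole : Fin (length patterns) ⊎ Fin k → Role
    bRole = [ blocker , spare ]′

    role : Fin (size G) → Role
    role = [ clique , [ aRole ∘ splitAt s , bRole ∘ splitAt (length patterns) ]′ ∘ splitAt a ]′ ∘ splitAt n

    role-aVertex : ∀ α → role (aVertex α) ≡ aRole (splitAt s α)
    role-aVertex α rewrite splitAt-join n (a + b) (inj₂ (join a b (inj₁ α))) | splitAt-join a b (inj₁ α) = refl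

    role-bVertex : ∀ β → role (bVertex β) ≡ bRole (splitAt (length patterns) β)
    role-bVertex β rewrite splitAt-join n (a + b) (inj₂ (join a b (inj₂ β))) | splitAt-join a b (inj₂ β) = refl

    role-vertex : ∀ ρ → role (vertex ρ) ≡ ρ
    role-vertex (clique i)  = cong [ clique , _ ]′ (splitAt-join n (a + b) (inj₁ i))
    role-vertex (owner t)   = trans (role-aVertex _) (cong aRole (splitAt-join s _ (inj₁ t)))
    role-vertex centre      = trans (role-aVertex _) (cong aRole (splitAt-join s _ (inj₂ zero)))
    role-vertex (shifted p) = trans (role-aVertex _) (trans (cong aRole (splitAt-join s _ (inj₂ (suc (join r e p)))))
                                                             (cong shifted (splitAt-join r e p)))
    role-vertex (blocker β) = trans (role-bVertex _) (cong bRole (splitAt-join _ k (inj₁ β)))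
    role-vertex (spare i)   = trans (role-bVertex _) (cong bRole (splitAt-join _ k (inj₂ i)))

    roleList : Role → Fin N → Colour
    roleList (clique _)  = base
    roleList (owner t)   = reserved t
    roleList centre      = base
    roleList (shifted p) = shiftedList p
    roleList (blocker β) = patternList (lookup patterns β)
    roleList (spare _)   = base

    roleList-injective : ∀ ρ → Injective _≡_ _≡_ (roleList ρ)
    roleList-injective (clique _)  = inj₁-injective
    roleList-injective (owner t)   = ,-injectiveʳ ∘ inj₂-injective ∘ inj₂-injective
    roleList-injective centre      = inj₁-injective
    roleList-injective (shifted p) = shiftedList-injective p
    roleList-injective (blocker β) = patternList-injective (lookup patterns β)
    roleList-injective (spare _)   = inj₁-injective

    clique-adj : ∀ i {w} → Adj G (vertex (clique i)) (join n (a + b) (inj₂ w))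
    clique-adj i {w} = adj-join (K n) (Kbip a b) (inj₁ i) (inj₂ w) tt

    aVertex-adj-bVertex : ∀ α β → Adj G (aVertex α) (bVertex β)
    aVertex-adj-bVertex α β = adj-join (K n) (Kbip a b) (inj₂ (join a b (inj₁ α))) (inj₂ (join a b (inj₂ β)))
                                       (adj-Kbip (inj₁ α) (inj₂ β) tt)

    module Blocking (κ : Fin (size G) → Fin N)
                    (proper : ∀ u v → Adj G u v → roleList (role u) (κ u) ≢ roleList (role v) (κ v)) where

      colour : Role → Colour
      colour ρ = roleList ρ (κ (vertex ρ))

      colour-proper : ∀ ρ σ → Adj G (vertex ρ) (vertex σ) → colour ρ ≢ colour σ
      colour-proper ρ σ adj = subst₂ (λ ρ′ σ′ → roleList ρ′ (κ (vertex ρ)) ≢ roleList σ′ (κ (vertex σ)))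
                                     (role-vertex ρ) (role-vertex σ) (proper (vertex ρ) (vertex σ) adj)

      Forbidden : Colour → Set
      Forbidden y = ∃ λ ρ → (∀ β → Adj G (vertex ρ) (vertex (blocker β))) × colour ρ ≡ y

      blocked : ∀ β → (∀ j → Forbidden (roleList (blocker β) j)) → ⊥
      blocked β forbidden = let (ρ , adj , eq) = forbidden (κ (vertex (blocker β))) in
        colour-proper ρ (blocker β) (adj β) eq

      forbidden-image : ∀ {m} {g : Fin m → Fin N} (c : Comb N m) → SameImage (elem c) g →
        (∀ j → Forbidden (base (g j))) → ∀ i → Forbidden (base (elem c i))
      forbidden-image c (c⊆g , _) forbidden i = let (j , eq) = c⊆g i in subst (Forbidden ∘ base) (sym eq) (forbidden j)

      T : Fin n → Fin N
      T i = κ (vertex (clique i))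

      x : Fin N
      x = κ (vertex centre)

      p : Fin r ⊎ Fin e
      p = part x

      z : Fin N
      z = κ (vertex (shifted p))

      T-injective : Injective _≡_ _≡_ T
      T-injective {i} {i′} eq with i ≟ᶠ i′
      ... | yes i≡i′ = i≡i′
      ... | no i≢i′  = ⊥-elim (colour-proper (clique i) (clique i′) (adj-join (K n) (Kbip a b) (inj₁ i) (inj₁ i′) i≢i′)
                                             (cong base eq))

      x∉T : ∀ i → T i ≢ x
      x∉T i eq = colour-proper (clique i) centre (clique-adj i) (cong base eq)

      forbidden-T : ∀ i → Forbidden (base (T i))
      forbidden-T i = clique i , (λ _ → clique-adj i) , refl

      forbidden-x : Forbidden (base x)
      forbidden-x = centre , (λ _ → aVertex-adj-bVertex _ _) , refl

      forbidden-z : Forbidden (colour (shifted p))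
      forbidden-z = shifted p , (λ _ → aVertex-adj-bVertex _ _) , refl

      Forbids : Blocker → Set
      Forbids Y = Y ∈ blockers × ∀ i → Forbidden (blockerList Y i)

      full-forbidden : part z ≢ p → ∃ Forbids
      full-forbidden z∉p = full c , full-∈ c , forbidden-image c (proj₂ image) forbidden-g
        where
        colour-z : colour (shifted p) ≡ base z
        colour-z = shiftedList-outside z∉p
        z∉T : ∀ i → T i ≢ z
        z∉T i eq = colour-proper (clique i) (shifted p) (clique-adj i) (trans (cong base eq) (sym colour-z))
        x∉zT : ∀ i → (z ∷ᶠ T) i ≢ x
        x∉zT zero    z≡x = z∉p (cong part z≡x)
        x∉zT (suc i) = x∉T i
        g : Fin (suc (suc n)) → Fin N
        g = x ∷ᶠ z ∷ᶠ T
        image = image-comb g (∷-injective (∷-injective T-injective z∉T) x∉zT)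
        c = proj₁ image
        forbidden-g : ∀ j → Forbidden (base (g j))
        forbidden-g zero          = forbidden-x
        forbidden-g (suc zero)    = subst Forbidden colour-z forbidden-z
        forbidden-g (suc (suc i)) = forbidden-T i

      withRank-forbidden : part z ≡ p → ∃ Forbids
      withRank-forbidden z∈p = withRank (rank z) c , ∈-blockers , forbidden
        where
        g : Fin (suc n) → Fin N
        g = x ∷ᶠ T
        forbidden-g : ∀ j → Forbidden (base (g j))
        forbidden-g zero    = forbidden-x
        forbidden-g (suc i) = forbidden-T i
        image = image-comb g (∷-injective T-injective x∉T)
        c = proj₁ image
        forbidden : ∀ i → Forbidden (blockerList (withRank (rank z) c) i)
        forbidden zero    = subst Forbidden (shiftedList-inside z∈p) forbidden-z
        forbidden (suc i) = forbidden-image c (proj₂ image) forbidden-g i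
        ∈-blockers : withRank (rank z) c ∈ blockers
        ∈-blockers with rank z in rank≡
        ... | suc y = withRank-suc-∈ y c
        ... | zero  = let (i , elem≡x) = proj₂ (proj₂ image) zero
                          (x′ , x′≡x) = rank≡0⇒prefix rank≡ (sym z∈p)
                      in withRank-zero-∈ c i x′ (trans elem≡x (sym x′≡x))

      τ : Vec (Fin N) s
      τ = tabulate (κ ∘ vertex ∘ owner)

      absurd : ⊥
      absurd = blocked (index P∈) λ j →
        subst (λ P → Forbidden (patternList P j)) (lookup-index P∈) (forbidden-entry (split j))
        where
        forbids : ∃ Forbids
        forbids with part z ≟ₚ p
        ... | yes z∈p = withRank-forbidden z∈p
        ... | no z∉p  = full-forbidden z∉p
        Y = proj₁ forbids
        P∈ : (τ , Y) ∈ patterns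
        P∈ = ∈-cartesianProductWith⁺ _,_ (∈-allVecs ∈-allFin τ) (proj₁ (proj₂ forbids))
        forbidden-entry : ∀ i → Forbidden (patternEntry (τ , Y) i)
        forbidden-entry (inj₁ t) = owner t , (λ _ → aVertex-adj-bVertex _ _) , cong (reserved t) (sym (lookup∘tabulate _ t))
        forbidden-entry (inj₂ i) = proj₂ (proj₂ forbids) i

    not-choosable : ¬ Choosable G N
    not-choosable choosable =
      let (κ , proper) = choosable⇒proper-from G encode encode-injective choosable (roleList ∘ role) (roleList-injective ∘ role)
      in Blocking.absurd κ proper

  not-choosable : ∀ {a b} → a ≡ s + suc (r + e) →
    N ^ s * (N C (suc n + 1) + (N C suc n) * (q + 1) ∸ (e * q) C suc n) ≤ b → ¬ Choosable (K n ∨ Kbip a b) N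
  not-choosable {b = b} refl bound =
    subst (λ b′ → ¬ Choosable (K n ∨ Kbip _ b′) N) (m+[n∸m]≡n (subst (_≤ b) (sym length-patterns) bound))
          (Assignment.not-choosable (b ∸ length patterns))

-- Arithmetic of the division N = q d + r

quotient-decomposition : ∀ M d .{{_ : NonZero d}} → M ≡ M % d * suc (M / d) + (d ∸ M % d) * (M / d)
quotient-decomposition M d = begin
  M                        ≡⟨ m≡m%n+[m/n]*n M d ⟩
  r + q * d                ≡⟨ cong (λ x → r + q * x) (m+[n∸m]≡n (m%n≤n M d)) ⟨
  r + q * (r + (d ∸ r))    ≡⟨ regroup r (d ∸ r) q ⟩
  r * suc q + (d ∸ r) * q  ∎
  where
  open ≡-Reasoning
  q = M / d
  r = M % d
  regroup : ∀ r e q → r + q * (r + e) ≡ r * suc q + e * q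
  regroup = solve-∀

quotient-excess : ∀ M d .{{_ : NonZero d}} → (1 + M / d) * d ∸ M ≡ d ∸ M % d
quotient-excess M d = begin
  (1 + q) * d ∸ M            ≡⟨ cong ((1 + q) * d ∸_) (m≡m%n+[m/n]*n M d) ⟩
  (1 + q) * d ∸ (r + q * d)  ≡⟨ cong₂ _∸_ (expand q d) (+-comm r (q * d)) ⟩
  (q * d + d) ∸ (q * d + r)  ≡⟨ [m+n]∸[m+o]≡n∸o (q * d) d r ⟩
  d ∸ r                      ∎
  where
  open ≡-Reasoning
  q = M / d
  r = M % d
  expand : ∀ q d → (1 + q) * d ≡ q * d + d
  expand = solve-∀

K∨Kbip-not-choosable : ∀ s l₁ a b (h : s + 2 < a) →
  let N = suc l₁ + s + 1
      q = _/_ N (a ∸ (s + 1)) {{diffNonZero s a h}}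
      u = ((1 + q) * (a ∸ (s + 1)) ∸ N) * q
  in N ^ s * ((N C (suc l₁ + 1)) + (N C suc l₁) * (q + 1) ∸ (u C suc l₁)) ≤ b →
     ¬ Choosable (K l₁ ∨ Kbip a b) (l₁ + 2 + s)
K∨Kbip-not-choosable s l₁ a b h bound =
  subst (¬_ ∘ Choosable (K l₁ ∨ Kbip a b)) (trans (sym M≡N) (reorder l₁ s))
    (Construction.not-choosable s l₁ q r e (trans (reorder′ s l₁) M≡N) a≡ bound′)
  where
  instance _ = diffNonZero s a h
  d = a ∸ (s + 1)
  M = suc l₁ + s + 1
  q = M / d
  r = M % d
  e = d ∸ r
  M≡N : M ≡ r * suc q + e * q
  M≡N = quotient-decomposition M d
  reorder : ∀ l₁ s → suc l₁ + s + 1 ≡ l₁ + 2 + s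
  reorder = solve-∀
  reorder′ : ∀ s l₁ → s + suc (suc l₁) ≡ suc l₁ + s + 1
  reorder′ = solve-∀
  a≡ : a ≡ s + suc (r + e)
  a≡ = begin
    a                ≡⟨ m+[n∸m]≡n (≤-trans (+-monoʳ-≤ s (s≤s z≤n)) (<⇒≤ h)) ⟨
    s + 1 + d        ≡⟨ +-assoc s 1 d ⟩
    s + suc d        ≡⟨ cong (λ x → s + suc x) (m+[n∸m]≡n (m%n≤n M d)) ⟨
    s + suc (r + e)  ∎
    where open ≡-Reasoning
  bound′ : (r * suc q + e * q) ^ s * ((r * suc q + e * q) C (suc l₁ + 1)
             + ((r * suc q + e * q) C suc l₁) * (q + 1) ∸ (e * q) C suc l₁) ≤ b
  bound′ = subst₂ (λ X U → X ^ s * ((X C (suc l₁ + 1)) + (X C suc l₁) * (q + 1) ∸ (U C suc l₁)) ≤ b)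
                  M≡N (cong (_* q) (quotient-excess M d)) bound

theorem9 : (s l a : ℕ) → 2 ≤ l → (h : s + 2 < a) → ¬ (a ∸ (s + 1) ∣ l + s + 1) →
    let q = _/_ (l + s + 1) (a ∸ (s + 1)) {{diffNonZero s a h}}
        u = ((1 + q) * (a ∸ (s + 1)) ∸ (l + s + 1)) * q
    in (b : ℕ) → a ≤ b →
    (l + s + 1) ^ s * (((l + s + 1) C (l + 1)) + ((l + s + 1) C l) * (q + 1) ∸ (u C l)) ≤ b →
    τ≥ s a b l
theorem9 s zero     a () h _ b _ bound
theorem9 s (suc l₁) a _  h _ b _ bound n χ χℓ is-χ is-χℓ gap with suc l₁ ≤? n
... | yes l≤n = l≤n
... | no l≰n  = ⊥-elim (K∨Kbip-not-choosable s l₁ a b h bound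
                  (K∨-choosable-from-gap (Kbip a b) (≤-pred (≰⇒> l≰n)) (Kbip-colorable a b) is-χ is-χℓ gap))
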